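{- If $n \geq 4$, then the scramble number of the strip graph $G_n$ is $\mathrm{sn}(G_n) = 3$.
   Context: The strip graph $G_n$ has vertices $v_0,\ldots,v_n$ and an edge between $v_i$ and $v_j$ exactly when $|i-j|\in\{1,2\}$. A scramble $\mathcal{S}$ on a connected graph $G$ is a finite nonempty collection of nonempty vertex subsets (eggs), each inducing a connected subgraph. Its hitting number $h(\mathcal{S})$ is the minimum size of a vertex set meeting every egg; its egg-cut number $e(\mathcal{S})$ is the minimum size of an edge set whose deletion disconnects $G$ so that some two eggs lie in different components (infinite if no such set exists). The order of $\mathcal{S}$ is $\min\{h(\mathcal{S}), e(\mathcal{S})\}$, and the scramble number $\mathrm{sn}(G)$ is the maximum order of a scramble on $G$. -}

module Defs where

open import Data.Nat using (ℕ; suc; _≤_; _⊔_; _⊓_)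
open import Data.Fin using (Fin; toℕ)
open import Data.Fin.Subset using (Subset; _∈_; _∉_)
open import Data.List using (List; length; [])
open import Data.List.Relation.Unary.Any using (Any)
import Data.List.Membership.Propositional as LM
open import Data.Maybe using (Maybe; just; nothing)
open import Data.Product using (Σ; ∃; ∃-syntax; _×_; _,_)
open import Data.Sum using (_⊎_)
open import Relation.Nullary using (¬_)
open import Relation.Binary.PropositionalEquality using (_≡_)
open import Relation.Binary.Construct.Closure.ReflexiveTransitive using (Star)
open import Level using (0ℓ)

record Graph : Set₁ where
  field
    size : ℕ
    Adj  : Fin size → Fin size → Set
open Graph public

dist : ℕ → ℕ → ℕ
dist a b = (a ⊔ b) Data.Nat.∸ (a ⊓ b)

-- Strip graph G_n : vertices v_0..v_n (Fin (suc n)), v_i ~ v_j iff |i - j| ∈ {1,2}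
strip : ℕ → Graph
strip n = record
  { size = suc n
  ; Adj  = λ i j → dist (toℕ i) (toℕ j) ≡ 1 ⊎ dist (toℕ i) (toℕ j) ≡ 2 }

module _ (G : Graph) where
  private
    V = Fin (size G)

  Reach : (V → V → Set) → V → V → Set
  Reach R = Star R

  Connected : Set
  Connected = ∀ u v → Reach (Adj G) u v

  Egg : Subset (size G) → Set
  Egg E = (∃[ v ] v ∈ E) ×
          (∀ u v → u ∈ E → v ∈ E → Reach (λ a b → Adj G a b × a ∈ E × b ∈ E) u v)

  Scramble : Set
  Scramble = Σ (List (Subset (size G))) λ S → ¬ (S ≡ []) × (∀ E → E LM.∈ S → Egg E)

  eggs : Scramble → List (Subset (size G))
  eggs (S , _) = S

  Hits : Scramble → List V → Set
  Hits S H = ∀ E → E LM.∈ eggs S → ∃[ v ] (v LM.∈ H × v ∈ E)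

  IsHittingNumber : Scramble → ℕ → Set
  IsHittingNumber S k =
    (∃[ H ] (Hits S H × length H ≡ k)) × (∀ H → Hits S H → k ≤ length H)

  AdjMinus : List (V × V) → V → V → Set
  AdjMinus F u v = Adj G u v × ¬ ((u , v) LM.∈ F) × ¬ ((v , u) LM.∈ F)

  IsEggCut : Scramble → List (V × V) → Set
  IsEggCut S F =
    (∀ u v → (u , v) LM.∈ F → Adj G u v) ×
    (∃[ E₁ ] ∃[ E₂ ] (E₁ LM.∈ eggs S × E₂ LM.∈ eggs S ×
       (∀ u v → u ∈ E₁ → v ∈ E₁ → Reach (AdjMinus F) u v) ×
       (∀ u v → u ∈ E₂ → v ∈ E₂ → Reach (AdjMinus F) u v) ×
       (∀ u v → u ∈ E₁ → v ∈ E₂ → ¬ Reach (AdjMinus F) u v)))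

  -- e(S) : just k = minimum size of an egg-cut; nothing = infinite (no egg-cut)
  IsEggCutNumber : Scramble → Maybe ℕ → Set
  IsEggCutNumber S (just k) =
    (∃[ F ] (IsEggCut S F × length F ≡ k)) × (∀ F → IsEggCut S F → k ≤ length F)
  IsEggCutNumber S nothing = ∀ F → ¬ IsEggCut S F

  minInf : ℕ → Maybe ℕ → ℕ
  minInf h (just e) = h ⊓ e
  minInf h nothing  = h

  IsOrder : Scramble → ℕ → Set
  IsOrder S k = ∃[ h ] ∃[ e ] (IsHittingNumber S h × IsEggCutNumber S e × k ≡ minInf h e)

  IsScrambleNumber : ℕ → Set
  IsScrambleNumber k =
    (∃[ S ] IsOrder S k) × (∀ S m → IsOrder S m → m ≤ k)

-- Let a be least such that some egg E₁ lies in {v₀,…,v_a}.  Edges of the strip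
-- join vertices at most two apart, so at most three edges join {v₀,…,v_a} to the rest.  If some
-- egg E₂ lies entirely beyond v_a, these edges form an egg-cut separating E₁ from E₂.  Otherwise,
-- by minimality of a, every egg has vertices on both sides of the threshold, and being connected
-- it contains v_a or v_{a-1}; so {v_a, v_{a-1}} is a hitting set.  Either way the order is ≤ 3.
--
-- The eggs {v₀,v₁}, {v₂}, {v₃,v₄} are pairwise disjoint, so h = 3.  Any two
-- of them are joined by three edge-disjoint walks, each of which an egg-cut must meet, so e ≥ 3;
-- and the three edges leaving {v₀,v₁} form an egg-cut.

module Submission where

open import Defs
open import Data.Nat as ℕ using (ℕ; zero; suc; pred; _+_; _≤_; _<_; _≤?_; _<?_; z≤n; s≤s; ∣_-_∣)
open import Data.Nat.Properties
  using ( ≤-refl; ≤-trans; ≤-antisym; <⇒≱; ≰⇒>; ≮⇒≥; m≤n⇒m≤1+n; +-monoʳ-≤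
        ; m⊓n≤m; m⊓n≤n; m≤n⇒m⊓n≡m; m≤n+∣n-m∣; ∣-∣-comm)
open import Data.Fin using (Fin; zero; suc; toℕ; fromℕ<; #_)
open import Data.Fin.Properties
  using (toℕ-injective; toℕ-fromℕ<; toℕ≤pred[n]; _≟_; all?; ¬∀⟶∃¬; injective⇒≤; <-cmp)
open import Data.Fin.Subset using (Subset; _∈_; _∪_; ⁅_⁆)
open import Data.Fin.Subset.Properties using (_∈?_; x∈⁅x⁆; x∈⁅y⁆⇒x≡y; x∈p∪q⁺; x∈p∪q⁻)
open import Data.List using (List; []; _∷_; length; filter; lookup; tabulate)
open import Data.List.Properties using (length-filter)
open import Data.List.Relation.Unary.All as All using (All)
open import Data.List.Relation.Unary.Any using (Any; here; there; index; any?)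
open import Data.List.Relation.Unary.Any.Properties using (lookup-index)
open import Data.List.Membership.Propositional using (find; lose) renaming (_∈_ to _∈ₗ_)
open import Data.List.Membership.Propositional.Properties
  using (∈-filter⁺; ∈-filter⁻; ∈-tabulate⁺; ∈-tabulate⁻)
import Data.List.Membership.DecPropositional as DecMembership
open import Data.Maybe using (just; nothing)
open import Data.Product using (∃; _×_; _,_; proj₁; proj₂; map₂; swap)
open import Data.Product.Properties using (≡-dec)
open import Data.Sum as Sum using (_⊎_; inj₁; inj₂)
open import Function using (_∘_; id; const)
open import Function.Definitions using (Injective)
open import Level using (0ℓ)
open import Relation.Binary using (Rel; Decidable; tri<; tri≈; tri>)
open import Relation.Binary.PropositionalEquality
  using (_≡_; _≢_; refl; sym; trans; cong; cong₂; subst; module ≡-Reasoning)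
open import Relation.Binary.Construct.Closure.ReflexiveTransitive using (Star; ε; _◅_; gmap; reverse)
open import Relation.Binary.Construct.Closure.ReflexiveTransitive.Properties
  using (module StarReasoning)
open import Relation.Nullary using (¬_; Dec; yes; no; contradiction; ¬?)
open import Relation.Nullary.Decidable using (_×-dec_; _⊎-dec_; _→-dec_; from-yes)
open import Relation.Unary using (Pred)

least-witness : ∀ {P : ℕ → Set} → (∀ a → Dec (P a)) → ∀ {n} → P n →
                ∃ λ a → P a × (∀ {b} → b < a → ¬ P b)
least-witness P? {n} pn with P? 0
... | yes p0 = 0 , p0 , λ ()
least-witness P? {zero}  pn | no ¬p0 = contradiction pn ¬p0
least-witness P? {suc n} pn | no ¬p0 with least-witness (P? ∘ suc) pn
... | a , pa , least = suc a , pa , λ { {zero} _ → ¬p0 ; {suc b} (s≤s b<a) → least b<a }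

dist≡∣-∣ : ∀ a b → dist a b ≡ ∣ a - b ∣
dist≡∣-∣ zero    b       = refl
dist≡∣-∣ (suc a) zero    = refl
dist≡∣-∣ (suc a) (suc b) = dist≡∣-∣ a b

crossing-positions : ∀ {p a q} → p ≤ a → a < q → q ≤ p + 2 →
                     (p ≡ a × (q ≡ suc a ⊎ q ≡ suc (suc a))) ⊎ (suc p ≡ a × q ≡ suc a)
crossing-positions {zero} {zero}        {suc zero}          _ _ _ = inj₁ (refl , inj₁ refl)
crossing-positions {zero} {zero}        {suc (suc zero)}    _ _ _ = inj₁ (refl , inj₂ refl)
crossing-positions {zero} {suc zero}    {suc (suc zero)}    _ _ _ = inj₂ (refl , refl)
crossing-positions {zero} {suc _}       {suc zero}          _ (s≤s ()) _
crossing-positions {zero} {suc (suc _)} {suc (suc zero)}    _ (s≤s (s≤s ())) _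
crossing-positions {zero} {_}           {suc (suc (suc _))} _ _ (s≤s (s≤s ()))
crossing-positions {suc p} {suc a} {suc q} (s≤s p≤a) (s≤s a<q) (s≤s q≤p+2)
  with crossing-positions p≤a a<q q≤p+2
... | inj₁ (p≡a , q≡)      = inj₁ (cong suc p≡a , Sum.map (cong suc) (cong suc) q≡)
... | inj₂ (1+p≡a , q≡1+a) = inj₂ (cong suc 1+p≡a , cong suc q≡1+a)

injection⇒≤length : ∀ {A : Set} {k} {xs : List A} (f : Fin k → A) → Injective _≡_ _≡_ f →
                    (∀ i → f i ∈ₗ xs) → k ≤ length xs
injection⇒≤length {xs = xs} f f-injective f∈ = injective⇒≤ position-injective
  where
  position-injective : Injective _≡_ _≡_ (index ∘ f∈)
  position-injective {i} {j} same-position = f-injective (begin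
    f i                      ≡⟨ lookup-index (f∈ i) ⟩
    lookup xs (index (f∈ i)) ≡⟨ cong (lookup xs) same-position ⟩
    lookup xs (index (f∈ j)) ≡⟨ sym (lookup-index (f∈ j)) ⟩
    f j                      ∎)
    where open ≡-Reasoning

∃-counterexample : ∀ {k} {P : Pred (Fin k) 0ℓ} (E : Subset k) → (∀ v → Dec (P v)) →
                   ¬ (∀ v → v ∈ E → P v) → ∃ λ v → v ∈ E × ¬ P v
∃-counterexample {k} {P} E P? ¬all
  with ¬∀⟶∃¬ k (λ v → v ∈ E → P v) (λ v → v ∈? E →-dec P? v) ¬all
... | v , counter with v ∈? E
...   | yes v∈E = v , v∈E , counter ∘ const
...   | no v∉E  = contradiction (λ v∈E → contradiction v∈E v∉E) counter

∈-pair⁻ : ∀ {k} (x y : Fin k) {v} → v ∈ ⁅ x ⁆ ∪ ⁅ y ⁆ → v ≡ x ⊎ v ≡ y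
∈-pair⁻ x y = Sum.map (x∈⁅y⁆⇒x≡y x) (x∈⁅y⁆⇒x≡y y) ∘ x∈p∪q⁻ ⁅ x ⁆ ⁅ y ⁆

∈-pairˡ : ∀ {k} (x y : Fin k) → x ∈ ⁅ x ⁆ ∪ ⁅ y ⁆
∈-pairˡ x y = x∈p∪q⁺ (inj₁ (x∈⁅x⁆ x))

∈-pairʳ : ∀ {k} (x y : Fin k) → y ∈ ⁅ x ⁆ ∪ ⁅ y ⁆
∈-pairʳ x y = x∈p∪q⁺ (inj₂ (x∈⁅x⁆ y))

module _ (G : Graph) where
  private
    V : Set
    V = Fin (size G)

  open DecMembership (≡-dec {A = V} {B = λ _ → V} _≟_ _≟_) using () renaming (_∈?_ to _∈ₗ?_)

  scramble-egg : ∀ (S : Scramble G) {E} → E ∈ₗ eggs G S → Egg G E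
  scramble-egg (_ , _ , isEgg) = isEgg _

  Separates : List (V × V) → Subset (size G) → Subset (size G) → Set
  Separates F E₁ E₂ = ∀ u v → u ∈ E₁ → v ∈ E₂ → ¬ Reach G (AdjMinus G F) u v

  ¬separates-self : ∀ {F E} → Egg G E → ¬ Separates F E E
  ¬separates-self ((v , v∈) , _) separated = separated v v v∈ v∈ ε

  separates-sym : (∀ u v → Adj G u v → Adj G v u) → ∀ {F E₁ E₂} →
                  Separates F E₁ E₂ → Separates F E₂ E₁
  separates-sym adj-sym separated u v u∈ v∈ =
    separated v u v∈ u∈ ∘ reverse (λ (adj , uv∉ , vu∉) → adj-sym _ _ adj , vu∉ , uv∉)

  order≤hitting : ∀ {S m H} → IsOrder G S m → Hits G S H → m ≤ length H
  order≤hitting (h , just e  , (_ , h-least) , _ , refl) hits =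
    ≤-trans (m⊓n≤m h e) (h-least _ hits)
  order≤hitting (h , nothing , (_ , h-least) , _ , refl) hits = h-least _ hits

  order≤eggCut : ∀ {S m F} → IsOrder G S m → IsEggCut G S F → m ≤ length F
  order≤eggCut (h , just e  , _ , (_ , e-least) , refl) cut =
    ≤-trans (m⊓n≤n h e) (e-least _ cut)
  order≤eggCut (h , nothing , _ , no-cut , refl) cut = contradiction cut (no-cut _)

  disjoint-eggs⇒≤hitting : ∀ {k} (S : Scramble G) (E : Fin k → Subset (size G)) →
                           (∀ i → E i ∈ₗ eggs G S) → (∀ {i j v} → v ∈ E i → v ∈ E j → i ≡ j) →
                           ∀ {H} → Hits G S H → k ≤ length H
  disjoint-eggs⇒≤hitting S E E∈ disjoint hits =
    injection⇒≤length (proj₁ ∘ hit) hit-injective (proj₁ ∘ proj₂ ∘ hit)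
    where
    hit : ∀ i → ∃ λ v → v ∈ₗ _ × v ∈ E i
    hit i = hits (E i) (E∈ i)
    hit-injective : Injective _≡_ _≡_ (proj₁ ∘ hit)
    hit-injective {i} {j} same =
      disjoint (proj₂ (proj₂ (hit i))) (subst (_∈ E j) (sym same) (proj₂ (proj₂ (hit j))))

  ⁅⁆-egg : ∀ x → Egg G ⁅ x ⁆
  ⁅⁆-egg x = (x , x∈⁅x⁆ x) , connected
    where
    E = ⁅ x ⁆
    connected : ∀ u v → u ∈ E → v ∈ E → Reach G (λ a b → Adj G a b × a ∈ E × b ∈ E) u v
    connected u v u∈ v∈ with x∈⁅y⁆⇒x≡y x u∈ | x∈⁅y⁆⇒x≡y x v∈
    ... | refl | refl = ε

  edge-egg : ∀ x y → Adj G x y → Adj G y x → Egg G (⁅ x ⁆ ∪ ⁅ y ⁆)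
  edge-egg x y xy yx = (x , ∈-pairˡ x y) , connected
    where
    E = ⁅ x ⁆ ∪ ⁅ y ⁆
    connected : ∀ u v → u ∈ E → v ∈ E → Reach G (λ a b → Adj G a b × a ∈ E × b ∈ E) u v
    connected u v u∈ v∈ with ∈-pair⁻ x y u∈ | ∈-pair⁻ x y v∈
    ... | inj₁ refl | inj₁ refl = ε
    ... | inj₂ refl | inj₂ refl = ε
    ... | inj₁ refl | inj₂ refl = (xy , u∈ , v∈) ◅ ε
    ... | inj₂ refl | inj₁ refl = (yx , u∈ , v∈) ◅ ε

  egg-connected-avoiding : ∀ {E F} → Egg G E → (∀ {u v} → u ∈ E → v ∈ E → ¬ (u , v) ∈ₗ F) →
                           ∀ u v → u ∈ E → v ∈ E → Reach G (AdjMinus G F) u v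
  egg-connected-avoiding (_ , connected) avoids u v u∈ v∈ =
    gmap id (λ (adj , a∈ , b∈) → adj , avoids a∈ b∈ , avoids b∈ a∈) (connected u v u∈ v∈)

  edges : ∀ {x y} → Star (Adj G) x y → List (V × V)
  edges ε                    = []
  edges (_◅_ {u} {v} _ walk) = (u , v) ∷ edges walk

  Traverses : ∀ {x y} → V × V → Star (Adj G) x y → Set
  Traverses e walk = e ∈ₗ edges walk ⊎ swap e ∈ₗ edges walk

  traverses? : ∀ {x y} e (walk : Star (Adj G) x y) → Dec (Traverses e walk)
  traverses? e walk = (e ∈ₗ? edges walk) ⊎-dec (swap e ∈ₗ? edges walk)

  walk-meets-cut : ∀ F {x y} (walk : Star (Adj G) x y) → ¬ Reach G (AdjMinus G F) x y →
                   ∃ λ e → e ∈ₗ F × Traverses e walk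
  walk-meets-cut F ε unreachable = contradiction ε unreachable
  walk-meets-cut F (_◅_ {x} {z} adj walk) unreachable with (x , z) ∈ₗ? F | (z , x) ∈ₗ? F
  ... | yes xz∈F | _        = (x , z) , xz∈F , inj₁ (here refl)
  ... | no _     | yes zx∈F = (z , x) , zx∈F , inj₂ (here refl)
  ... | no xz∉F  | no zx∉F  = map₂ (map₂ (Sum.map there there))
    (walk-meets-cut F walk (unreachable ∘ ((adj , xz∉F , zx∉F) ◅_)))

  record Link (E₁ E₂ : Subset (size G)) : Set where
    constructor link
    field
      {source target} : V
      source∈ : source ∈ E₁
      target∈ : target ∈ E₂
      walk    : Star (Adj G) source target
  open Link

  EdgeDisjoint : ∀ {k E₁ E₂} → (Fin k → Link E₁ E₂) → Set
  EdgeDisjoint links =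
    ∀ i j → i ≢ j → All (λ e → ¬ Traverses e (walk (links j))) (edges (walk (links i)))

  edgeDisjoint? : ∀ {k E₁ E₂} (links : Fin k → Link E₁ E₂) → Dec (EdgeDisjoint links)
  edgeDisjoint? links = all? λ i → all? λ j → ¬? (i ≟ j) →-dec
    All.all? (λ e → ¬? (traverses? e (walk (links j)))) (edges (walk (links i)))

  edgeDisjoint⇒≤length : ∀ {k E₁ E₂ F} (links : Fin k → Link E₁ E₂) → EdgeDisjoint links →
                          Separates F E₁ E₂ → k ≤ length F
  edgeDisjoint⇒≤length {F = F} links disjoint separated =
    injection⇒≤length (proj₁ ∘ blocker) blocker-injective (proj₁ ∘ proj₂ ∘ blocker)
    where
    blocker : ∀ i → ∃ λ e → e ∈ₗ F × Traverses e (walk (links i))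
    blocker i = walk-meets-cut F (walk (links i)) (separated _ _ (source∈ (links i)) (target∈ (links i)))
    traversal : ∀ i → Traverses (proj₁ (blocker i)) (walk (links i))
    traversal = proj₂ ∘ proj₂ ∘ blocker
    traversed-once : ∀ {i j e} → i ≢ j → Traverses e (walk (links i)) → ¬ Traverses e (walk (links j))
    traversed-once i≢j (inj₁ e∈)      = All.lookup (disjoint _ _ i≢j) e∈
    traversed-once i≢j (inj₂ swap-e∈) = All.lookup (disjoint _ _ i≢j) swap-e∈ ∘ Sum.swap
    blocker-injective : Injective _≡_ _≡_ (proj₁ ∘ blocker)
    blocker-injective {i} {j} same with i ≟ j
    ... | yes i≡j = i≡j
    ... | no i≢j  = contradiction (subst (λ e → Traverses e (walk (links j))) (sym same) (traversal j))
                                  (traversed-once i≢j (traversal i))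

module Bandwidth≤2 {n : ℕ} (R : Rel (Fin (suc n)) 0ℓ) (R? : Decidable R)
                   (span≤2 : ∀ u v → R u v → ∣ toℕ u - toℕ v ∣ ≤ 2) where

  G : Graph
  G = record { size = suc n ; Adj = R }

  V : Set
  V = Fin (suc n)

  adj⇒≤+2 : ∀ {u v} → R u v → toℕ v ≤ toℕ u + 2
  adj⇒≤+2 {u} {v} uv = ≤-trans (m≤n+∣n-m∣ (toℕ v) (toℕ u)) (+-monoʳ-≤ (toℕ u) (span≤2 u v uv))

  vertexAt : ℕ → V
  vertexAt i = fromℕ< (s≤s (m⊓n≤n i n))

  toℕ≡⇒≡vertexAt : ∀ {u i} → toℕ u ≡ i → u ≡ vertexAt i
  toℕ≡⇒≡vertexAt {u} refl =
    toℕ-injective (sym (trans (toℕ-fromℕ< _) (m≤n⇒m⊓n≡m (toℕ≤pred[n] u))))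

  Below Above : ℕ → Subset (suc n) → Set
  Below a E = ∀ v → v ∈ E → toℕ v ≤ a
  Above a E = ∀ v → v ∈ E → a < toℕ v

  below? : ∀ a E → Dec (Below a E)
  below? a E = all? λ v → v ∈? E →-dec toℕ v ≤? a

  above? : ∀ a E → Dec (Above a E)
  above? a E = all? λ v → v ∈? E →-dec a <? toℕ v

  Crosses : ℕ → V × V → Set
  Crosses a (u , v) = R u v × toℕ u ≤ a × a < toℕ v

  crosses? : ∀ a → (e : V × V) → Dec (Crosses a e)
  crosses? a (u , v) = R? u v ×-dec toℕ u ≤? a ×-dec a <? toℕ v

  -- Since edges span at most 2, these are the only possible edges from {v₀,…,v_a} to the rest.
  -- Positions beyond n are clamped by vertexAt; crossing filters out the resulting junk pairs.
  candidates : ℕ → List (V × V)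
  candidates a = (vertexAt a , vertexAt (suc a)) ∷ (vertexAt a , vertexAt (suc (suc a)))
               ∷ (vertexAt (pred a) , vertexAt (suc a)) ∷ []

  crossing : ℕ → List (V × V)
  crossing a = filter (crosses? a) (candidates a)

  length-crossing≤3 : ∀ {a} → length (crossing a) ≤ 3
  length-crossing≤3 {a} = length-filter (crosses? a) (candidates a)

  crossing-sound : ∀ {a e} → e ∈ₗ crossing a → Crosses a e
  crossing-sound {a} = proj₂ ∘ ∈-filter⁻ (crosses? a)

  crossing-complete : ∀ {a u v} → Crosses a (u , v) → (u , v) ∈ₗ crossing a
  crossing-complete {a} {u} {v} crosses@(uv , u≤a , a<v) =
    ∈-filter⁺ (crosses? a) (candidate (crossing-positions u≤a a<v (adj⇒≤+2 uv))) crosses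
    where
    at : ∀ {i j} → toℕ u ≡ i → toℕ v ≡ j → (u , v) ≡ (vertexAt i , vertexAt j)
    at u≡i v≡j = cong₂ _,_ (toℕ≡⇒≡vertexAt u≡i) (toℕ≡⇒≡vertexAt v≡j)
    candidate : (toℕ u ≡ a × (toℕ v ≡ suc a ⊎ toℕ v ≡ suc (suc a))) ⊎
                (suc (toℕ u) ≡ a × toℕ v ≡ suc a) →
                (u , v) ∈ₗ candidates a
    candidate (inj₁ (u≡a , inj₁ v≡1+a)) = here (at u≡a v≡1+a)
    candidate (inj₁ (u≡a , inj₂ v≡2+a)) = there (here (at u≡a v≡2+a))
    candidate (inj₂ (1+u≡a , v≡1+a))    = there (there (here (at (cong pred 1+u≡a) v≡1+a)))

  below-closed : ∀ {a x y} → Reach G (AdjMinus G (crossing a)) x y → toℕ x ≤ a → toℕ y ≤ a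
  below-closed ε x≤a = x≤a
  below-closed (_◅_ {j = z} (xz , xz∉ , _) walk) x≤a =
    below-closed walk (≮⇒≥ (λ a<z → xz∉ (crossing-complete (xz , x≤a , a<z))))

  threshold-eggCut : ∀ (S : Scramble G) {a E₁ E₂} → E₁ ∈ₗ eggs G S → Below a E₁ →
                     E₂ ∈ₗ eggs G S → Above a E₂ → IsEggCut G S (crossing a)
  threshold-eggCut S {a} {E₁} {E₂} E₁∈ below E₂∈ above =
    (λ _ _ → proj₁ ∘ crossing-sound) , E₁ , E₂ , E₁∈ , E₂∈ ,
    egg-connected-avoiding G (scramble-egg G S E₁∈)
      (λ _ v∈ uv∈ → <⇒≱ (proj₂ (proj₂ (crossing-sound uv∈))) (below _ v∈)) ,
    egg-connected-avoiding G (scramble-egg G S E₂∈)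
      (λ u∈ _ uv∈ → <⇒≱ (above _ u∈) (proj₁ (proj₂ (crossing-sound uv∈)))) ,
    λ u v u∈ v∈ reach → <⇒≱ (above v v∈) (below-closed reach (below u u∈))

  egg-meets-threshold : ∀ {E a x w} → Star (λ p q → R p q × p ∈ E × q ∈ E) x w → x ∈ E →
                        toℕ x ≤ a → a ≤ toℕ w → ∃ λ y → y ∈ E × (toℕ y ≡ a ⊎ suc (toℕ y) ≡ a)
  egg-meets-threshold ε x∈ x≤a a≤x = _ , x∈ , inj₁ (≤-antisym x≤a a≤x)
  egg-meets-threshold {a = a} (_◅_ {j = y} (xy , x∈ , y∈) walk) _ x≤a a≤w with toℕ y ≤? a
  ... | yes y≤a = egg-meets-threshold walk y∈ y≤a a≤w
  ... | no y≰a  with crossing-positions x≤a (≰⇒> y≰a) (adj⇒≤+2 xy)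
  ...   | inj₁ (x≡a , _)   = _ , x∈ , inj₁ x≡a
  ...   | inj₂ (1+x≡a , _) = _ , x∈ , inj₂ 1+x≡a

  straddling-hits : ∀ (S : Scramble G) a →
                    (∀ {E} → E ∈ₗ eggs G S → ∃ λ u → u ∈ E × toℕ u ≤ a) →
                    (∀ {E} → E ∈ₗ eggs G S → ∃ λ w → w ∈ E × a ≤ toℕ w) →
                    Hits G S (vertexAt a ∷ vertexAt (pred a) ∷ [])
  straddling-hits S a low high E E∈ with low E∈ | high E∈
  ... | u , u∈ , u≤a | w , w∈ , a≤w
    with egg-meets-threshold (proj₂ (scramble-egg G S E∈) u w u∈ w∈) u∈ u≤a a≤w
  ...   | y , y∈ , inj₁ y≡a   = y , here (toℕ≡⇒≡vertexAt y≡a) , y∈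
  ...   | y , y∈ , inj₂ 1+y≡a = y , there (here (toℕ≡⇒≡vertexAt (cong pred 1+y≡a))) , y∈

  ¬Below⇒ : ∀ {a E} → ¬ Below a E → ∃ λ v → v ∈ E × a < toℕ v
  ¬Below⇒ {a} {E} ¬below with ∃-counterexample E (λ v → toℕ v ≤? a) ¬below
  ... | v , v∈ , v≰a = v , v∈ , ≰⇒> v≰a

  ¬Above⇒ : ∀ {a E} → ¬ Above a E → ∃ λ v → v ∈ E × toℕ v ≤ a
  ¬Above⇒ {a} {E} ¬above with ∃-counterexample E (λ v → a <? toℕ v) ¬above
  ... | v , v∈ , a≮v = v , v∈ , ≮⇒≥ a≮v

  threshold-dichotomy : ∀ S a → Any (Below a) (eggs G S) →
                        (∀ {E} → E ∈ₗ eggs G S → ∃ λ w → w ∈ E × a ≤ toℕ w) →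
                        (∃ λ H → Hits G S H × length H ≤ 2) ⊎
                        (∃ λ F → IsEggCut G S F × length F ≤ 3)
  threshold-dichotomy S a low reaches with any? (above? a) (eggs G S)
  ... | yes high = let E₁ , E₁∈ , below = find low
                       E₂ , E₂∈ , above = find high
                   in inj₂ (crossing a , threshold-eggCut S E₁∈ below E₂∈ above , length-crossing≤3)
  ... | no ¬high =
    inj₁ (_ , straddling-hits S a (λ E∈ → ¬Above⇒ (¬high ∘ lose E∈)) reaches , ≤-refl)

  egg-below-top : ∀ S → Any (Below n) (eggs G S)
  egg-below-top ([]    , nonempty , _) = contradiction refl nonempty
  egg-below-top (_ ∷ _ , _        , _) = here (λ v _ → toℕ≤pred[n] v)

  least-threshold : ∀ S → ∃ λ a → Any (Below a) (eggs G S) ×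
                                  (∀ {E} → E ∈ₗ eggs G S → ∃ λ w → w ∈ E × a ≤ toℕ w)
  least-threshold S =
    let a , low , least = least-witness (λ a → any? (below? a) (eggs G S)) (egg-below-top S)
    in  a , low , reaches least
    where
    reaches : ∀ {a} → (∀ {b} → b < a → ¬ Any (Below b) (eggs G S)) →
              ∀ {E} → E ∈ₗ eggs G S → ∃ λ w → w ∈ E × a ≤ toℕ w
    reaches {zero}  _     E∈ = let w , w∈ = proj₁ (scramble-egg G S E∈) in w , w∈ , z≤n
    reaches {suc b} least E∈ = ¬Below⇒ (least ≤-refl ∘ lose E∈)

  scrambleNumber≤3 : ∀ S m → IsOrder G S m → m ≤ 3
  scrambleNumber≤3 S m order with least-threshold S
  ... | a , low , reaches with threshold-dichotomy S a low reaches
  ... | inj₁ (H , hits , |H|≤2) = ≤-trans (order≤hitting G order hits) (m≤n⇒m≤1+n |H|≤2)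
  ... | inj₂ (F , cut , |F|≤3)  = ≤-trans (order≤eggCut G order cut) |F|≤3

module _ {n : ℕ} where
  strip-adj? : Decidable (Adj (strip n))
  strip-adj? u v = (dist (toℕ u) (toℕ v) ℕ.≟ 1) ⊎-dec (dist (toℕ u) (toℕ v) ℕ.≟ 2)

  strip-span≤2 : ∀ u v → Adj (strip n) u v → ∣ toℕ u - toℕ v ∣ ≤ 2
  strip-span≤2 u v uv = subst (_≤ 2) (dist≡∣-∣ (toℕ u) (toℕ v)) (dist≤2 uv)
    where
    dist≤2 : ∀ {d} → d ≡ 1 ⊎ d ≡ 2 → d ≤ 2
    dist≤2 (inj₁ refl) = s≤s z≤n
    dist≤2 (inj₂ refl) = ≤-refl

  strip-sym : ∀ u v → Adj (strip n) u v → Adj (strip n) v u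
  strip-sym u v = subst (λ d → d ≡ 1 ⊎ d ≡ 2) (begin
    dist (toℕ u) (toℕ v) ≡⟨ dist≡∣-∣ (toℕ u) (toℕ v) ⟩
    ∣ toℕ u - toℕ v ∣    ≡⟨ ∣-∣-comm (toℕ u) (toℕ v) ⟩
    ∣ toℕ v - toℕ u ∣    ≡⟨ sym (dist≡∣-∣ (toℕ v) (toℕ u)) ⟩
    dist (toℕ v) (toℕ u) ∎)
    where open ≡-Reasoning

  open Bandwidth≤2 (Adj (strip n)) strip-adj? strip-span≤2 public
    using (Below; Above; crossing; threshold-eggCut; scrambleNumber≤3)

module ThreeEggs (m : ℕ) where
  G : Graph
  G = strip (4 + m)

  V : Set
  V = Fin (5 + m)

  egg : Fin 3 → Subset (5 + m)
  egg zero             = ⁅ # 0 ⁆ ∪ ⁅ # 1 ⁆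
  egg (suc zero)       = ⁅ # 2 ⁆
  egg (suc (suc zero)) = ⁅ # 3 ⁆ ∪ ⁅ # 4 ⁆

  egg-isEgg : ∀ i → Egg G (egg i)
  egg-isEgg zero             = edge-egg G (# 0) (# 1) (inj₁ refl) (inj₁ refl)
  egg-isEgg (suc zero)       = ⁅⁆-egg G (# 2)
  egg-isEgg (suc (suc zero)) = edge-egg G (# 3) (# 4) (inj₁ refl) (inj₁ refl)

  scramble : Scramble G
  scramble = tabulate egg , (λ ()) , isEgg
    where
    isEgg : ∀ E → E ∈ₗ tabulate egg → Egg G E
    isEgg E E∈ with ∈-tabulate⁻ {f = egg} E∈
    ... | i , refl = egg-isEgg i

  egg∈ : ∀ i → egg i ∈ₗ eggs G scramble
  egg∈ = ∈-tabulate⁺ {f = egg}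

  egg-index : ∀ {E} → E ∈ₗ eggs G scramble → ∃ λ i → E ≡ egg i
  egg-index = ∈-tabulate⁻ {f = egg}

  block : V → Fin 3
  block zero                = # 0
  block (suc zero)          = # 0
  block (suc (suc zero))    = # 1
  block (suc (suc (suc _))) = # 2

  block-egg : ∀ {i v} → v ∈ egg i → block v ≡ i
  block-egg {zero} v∈ with ∈-pair⁻ (# 0) (# 1) v∈
  ... | inj₁ refl = refl
  ... | inj₂ refl = refl
  block-egg {suc zero} v∈ with x∈⁅y⁆⇒x≡y (# 2) v∈
  ... | refl = refl
  block-egg {suc (suc zero)} v∈ with ∈-pair⁻ (# 3) (# 4) v∈
  ... | inj₁ refl = refl
  ... | inj₂ refl = refl

  representative : Fin 3 → V
  representative = proj₁ ∘ proj₁ ∘ egg-isEgg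

  hittingNumber : IsHittingNumber G scramble 3
  hittingNumber = (tabulate representative , hits , refl) ,
                  λ H → disjoint-eggs⇒≤hitting G scramble egg egg∈
                          (λ v∈i v∈j → trans (sym (block-egg v∈i)) (block-egg v∈j))
    where
    hits : Hits G scramble (tabulate representative)
    hits E E∈ with egg-index E∈
    ... | i , refl =
      representative i , ∈-tabulate⁺ {f = representative} i , proj₂ (proj₁ (egg-isEgg i))

  eggCut : IsEggCut G scramble (crossing 1)
  eggCut = threshold-eggCut scramble (egg∈ (# 0)) egg₀-below (egg∈ (# 1)) egg₁-above
    where
    egg₀-below : Below 1 (egg (# 0))
    egg₀-below v v∈ with ∈-pair⁻ (# 0) (# 1) v∈
    ... | inj₁ refl = z≤n
    ... | inj₂ refl = s≤s z≤n
    egg₁-above : Above 1 (egg (# 1))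
    egg₁-above v v∈ with x∈⁅y⁆⇒x≡y (# 2) v∈
    ... | refl = s≤s (s≤s z≤n)

  open StarReasoning (Adj G)

  0∈egg₀ : # 0 ∈ egg (# 0)
  0∈egg₀ = ∈-pairˡ (# 0) (# 1)

  1∈egg₀ : # 1 ∈ egg (# 0)
  1∈egg₀ = ∈-pairʳ (# 0) (# 1)

  2∈egg₁ : # 2 ∈ egg (# 1)
  2∈egg₁ = x∈⁅x⁆ (# 2)

  3∈egg₂ : # 3 ∈ egg (# 2)
  3∈egg₂ = ∈-pairˡ (# 3) (# 4)

  4∈egg₂ : # 4 ∈ egg (# 2)
  4∈egg₂ = ∈-pairʳ (# 3) (# 4)

  links₀₁ : Fin 3 → Link G (egg (# 0)) (egg (# 1))
  links₀₁ zero             = link 0∈egg₀ 2∈egg₁ (begin # 0 ⟶⟨ inj₂ refl ⟩ # 2 ∎)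
  links₀₁ (suc zero)       = link 1∈egg₀ 2∈egg₁ (begin # 1 ⟶⟨ inj₁ refl ⟩ # 2 ∎)
  links₀₁ (suc (suc zero)) = link 1∈egg₀ 2∈egg₁ (begin # 1 ⟶⟨ inj₂ refl ⟩ # 3 ⟶⟨ inj₁ refl ⟩ # 2 ∎)

  links₀₂ : Fin 3 → Link G (egg (# 0)) (egg (# 2))
  links₀₂ zero             = link 1∈egg₀ 3∈egg₂ (begin # 1 ⟶⟨ inj₂ refl ⟩ # 3 ∎)
  links₀₂ (suc zero)       = link 0∈egg₀ 4∈egg₂ (begin # 0 ⟶⟨ inj₂ refl ⟩ # 2 ⟶⟨ inj₂ refl ⟩ # 4 ∎)
  links₀₂ (suc (suc zero)) = link 1∈egg₀ 3∈egg₂ (begin # 1 ⟶⟨ inj₁ refl ⟩ # 2 ⟶⟨ inj₁ refl ⟩ # 3 ∎)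

  links₁₂ : Fin 3 → Link G (egg (# 1)) (egg (# 2))
  links₁₂ zero             = link 2∈egg₁ 3∈egg₂ (begin # 2 ⟶⟨ inj₁ refl ⟩ # 3 ∎)
  links₁₂ (suc zero)       = link 2∈egg₁ 4∈egg₂ (begin # 2 ⟶⟨ inj₂ refl ⟩ # 4 ∎)
  links₁₂ (suc (suc zero)) = link 2∈egg₁ 3∈egg₂ (begin # 2 ⟶⟨ inj₁ refl ⟩ # 1 ⟶⟨ inj₂ refl ⟩ # 3 ∎)

  links₀₁-disjoint : EdgeDisjoint G links₀₁
  links₀₁-disjoint = from-yes (edgeDisjoint? G links₀₁)

  links₀₂-disjoint : EdgeDisjoint G links₀₂
  links₀₂-disjoint = from-yes (edgeDisjoint? G links₀₂)

  links₁₂-disjoint : EdgeDisjoint G links₁₂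
  links₁₂-disjoint = from-yes (edgeDisjoint? G links₁₂)

  separated-eggs≥3 : ∀ {i j F} → toℕ i < toℕ j → Separates G F (egg i) (egg j) → 3 ≤ length F
  separated-eggs≥3 {zero}           {suc zero}       _ = edgeDisjoint⇒≤length G links₀₁ links₀₁-disjoint
  separated-eggs≥3 {zero}           {suc (suc zero)} _ = edgeDisjoint⇒≤length G links₀₂ links₀₂-disjoint
  separated-eggs≥3 {suc zero}       {suc (suc zero)} _ = edgeDisjoint⇒≤length G links₁₂ links₁₂-disjoint
  separated-eggs≥3 {_}              {zero}           ()
  separated-eggs≥3 {suc zero}       {suc zero}       (s≤s ())
  separated-eggs≥3 {suc (suc zero)} {suc zero}       (s≤s ())
  separated-eggs≥3 {suc (suc zero)} {suc (suc zero)} (s≤s (s≤s ()))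

  eggCut-least : ∀ F → IsEggCut G scramble F → 3 ≤ length F
  eggCut-least F (_ , _ , _ , E₁∈ , E₂∈ , _ , _ , separated) with egg-index E₁∈ | egg-index E₂∈
  ... | i , refl | j , refl with <-cmp i j
  ... | tri< i<j _ _ = separated-eggs≥3 i<j separated
  ... | tri> _ _ j<i = separated-eggs≥3 j<i (separates-sym G strip-sym separated)
  ... | tri≈ _ refl _ = contradiction separated (¬separates-self G (egg-isEgg i))

  -- crossing 1 evaluates to the three edges v₀v₂, v₁v₂, v₁v₃.
  order : IsOrder G scramble 3
  order = 3 , just 3 , hittingNumber , ((crossing 1 , eggCut , refl) , eggCut-least) , refl

lemma5p6 : (n : ℕ) → 4 ≤ n → IsScrambleNumber (strip n) 3
lemma5p6 (suc (suc (suc (suc m)))) (s≤s (s≤s (s≤s (s≤s _)))) =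
  (ThreeEggs.scramble m , ThreeEggs.order m) , scrambleNumber≤3
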